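{- For integers $n\ge i\ge 0$, let $D_{n,i}$ be the number of G-Motzkin paths of length $n$ with exactly $i$ $\mathbf{d}$-steps. Then \[ D_{n,i}=\sum_{k=i}^{n-i}\binom{k}{i}\binom{n-i+k}{2k}C_k, \] where $C_k=\frac{1}{k+1}\binom{2k}{k}$ is the $k$-th Catalan number.
   Context: A G-Motzkin path of length $n$ is a lattice path from $(0,0)$ to $(n,0)$ that never goes below the $x$-axis and consists of up steps $\mathbf{u}=(1,1)$, down steps $\mathbf{d}=(1,-1)$, horizontal steps $\mathbf{h}=(1,0)$ and vertical steps $\mathbf{v}=(0,-1)$. -}

module Defs where

open import Data.Nat using (ℕ; zero; suc; _+_; _*_; _∸_; _/_)
open import Data.Nat.Combinatorics using (_C_)
open import Data.List using (List; []; _∷_; map; upTo)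
open import Data.Nat.ListAction using (sum)
open import Data.Product using (Σ; _×_)
open import Relation.Binary.PropositionalEquality using (_≡_)

-- Steps: u = (1,1), d = (1,-1), h = (1,0), v = (0,-1)
data Step : Set where
  u d h v : Step

-- A path is identified with its sequence of steps.
-- GWalk ht s : starting at height ht, the steps s never go below the x-axis
-- and end at height 0.
data GWalk : ℕ → List Step → Set where
  done : GWalk 0 []
  up   : ∀ {ht s} → GWalk (suc ht) s → GWalk ht (u ∷ s)
  down : ∀ {ht s} → GWalk ht s → GWalk (suc ht) (d ∷ s)
  hor  : ∀ {ht s} → GWalk ht s → GWalk ht (h ∷ s)
  vert : ∀ {ht s} → GWalk ht s → GWalk (suc ht) (v ∷ s)

-- horizontal length (x-displacement) of a step sequence
len : List Step → ℕ
len []       = 0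
len (v ∷ s)  = len s
len (_ ∷ s)  = suc (len s)

#d : List Step → ℕ
#d []       = 0
#d (d ∷ s)  = suc (#d s)
#d (_ ∷ s)  = #d s

GMotzkin : ℕ → ℕ → Set
GMotzkin n i = Σ (List Step) (λ s → GWalk 0 s × len s ≡ n × #d s ≡ i)

-- Catalan number C_k = binom(2k,k)/(k+1)  (exact division)
catalan : ℕ → ℕ
catalan k = ((2 * k) C k) / suc k

-- sumRange a b f = Σ_{k=a}^{b} f k  (empty if b < a)
sumRange : ℕ → ℕ → (ℕ → ℕ) → ℕ
sumRange a b f = sum (map (λ j → f (a + j)) (upTo (suc b ∸ a)))

-- Deleting the h-steps of a G-Motzkin path leaves a walk of u-, d- and v-steps, and the path is
-- recovered from it by the positions of the h-steps among all steps.  Reading every v-step of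
-- that walk as a d-step leaves a Dyck path, and the walk is recovered by choosing which of its
-- down-steps are d-steps.  If the Dyck path has semilength k and the path has i d-steps and
-- length n, this gives binom(k,i) choices for the d-steps, C_k Dyck paths, and
-- binom(n-i+k,2k) placements of the n-k-i h-steps among the 2k other steps.  Both
-- decompositions are carried out for walks from an arbitrary height, where Dyck paths are
-- counted by ballot numbers; the reflection formula for these gives C_k at height 0.

module Submission where

open import Defs
open import Data.Empty using (⊥-elim)
open import Data.Fin using (Fin)
open import Data.Fin.Properties using (+↔⊎; *↔×)
open import Data.List using (List; []; _∷_; map; upTo; applyUpTo)
open import Data.List.Properties using (map-upTo)
open import Data.Nat using (ℕ; zero; suc; _+_; _*_; _∸_; _≤_; _<_; _!; _/_; z≤n; s≤s; s≤s⁻¹)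
open import Data.Nat.Combinatorics
  using (_C_; nCk≡n!/k![n-k]!; nCk≡nC[n∸k]; nCn≡1; k![n∸k]!∣n!; nCk+nC[k+1]≡[n+1]C[k+1])
open import Data.Nat.DivMod using (m/n*n≡m; m*n/n≡m)
open import Data.Nat.ListAction using (sum)
open import Data.Nat.Properties
open import Data.Nat.Tactic.RingSolver using (solve-∀)
open import Data.Product using (Σ; Σ-syntax; _×_; _,_)
open import Data.Product.Function.Dependent.Propositional using (congˡ) renaming (cong to Σ-cong)
open import Data.Product.Function.NonDependent.Propositional using (_×-↔_)
open import Data.Sum using (_⊎_; inj₁; inj₂; [_,_]′)
open import Data.Sum.Function.Propositional using (_⊎-↔_)
open import Function.Bundles using (_↔_; mk↔ₛ′)
open import Function.Properties.Inverse using (↔-refl; ↔-sym; ↔-trans)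
open import Function.Related.Propositional using (module EquationalReasoning; bijection)
open import Relation.Binary.PropositionalEquality
open import Relation.Nullary.Irrelevant using (Irrelevant)

open import Algebra.Properties.CommutativeSemigroup +-commutativeSemigroup using (interchange)

pascal : ∀ n k → suc n C suc k ≡ n C k + n C suc k
pascal n k = sym (nCk+nC[k+1]≡[n+1]C[k+1] n k)

C-symmetric : ∀ j k → (j + k) C j ≡ (j + k) C k
C-symmetric j k = trans (nCk≡nC[n∸k] (m≤m+n j k)) (cong ((j + k) C_) (m+n∸m≡n j k))

C-factorials : ∀ j k → ((j + k) C j) * (j ! * k !) ≡ (j + k) !
C-factorials j k = begin
  ((j + k) C j) * (j ! * k !)                                ≡⟨ cong (λ r → ((j + k) C j) * (j ! * r !)) (m+n∸m≡n j k) ⟨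
  ((j + k) C j) * (j ! * (j + k ∸ j) !)                      ≡⟨ cong (_* (j ! * (j + k ∸ j) !)) (nCk≡n!/k![n-k]! j≤j+k) ⟩
  (j + k) ! / (j ! * (j + k ∸ j) !) * (j ! * (j + k ∸ j) !) ≡⟨ m/n*n≡m (k![n∸k]!∣n! j≤j+k) ⟩
  (j + k) !                                                  ∎
  where
  open ≡-Reasoning
  j≤j+k = m≤m+n j k
  instance _ = j !* (j + k ∸ j) !≢0

C-ratio : ∀ j k → suc k * ((suc j + k) C j) ≡ suc j * ((suc j + k) C suc j)
C-ratio j k = *-cancelʳ-≡ _ _ (j ! * k !) (begin
  suc k * (n C j) * (j ! * k !)       ≡⟨ regroup (suc k) (n C j) (j !) (k !) ⟩
  (n C j) * (j ! * suc k !)           ≡⟨ cong (λ m → (m C j) * (j ! * suc k !)) (+-suc j k) ⟨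
  ((j + suc k) C j) * (j ! * suc k !) ≡⟨ C-factorials j (suc k) ⟩
  (j + suc k) !                       ≡⟨ cong _! (+-suc j k) ⟩
  n !                                 ≡⟨ C-factorials (suc j) k ⟨
  (n C suc j) * (suc j ! * k !)       ≡⟨ regroup′ (suc j) (n C suc j) (j !) (k !) ⟨
  suc j * (n C suc j) * (j ! * k !)   ∎)
  where
  open ≡-Reasoning
  n = suc j + k
  instance _ = j !* k !≢0
  regroup : ∀ s c f g → s * c * (f * g) ≡ c * (f * (s * g))
  regroup = solve-∀
  regroup′ : ∀ s c f g → s * c * (f * g) ≡ c * ((s * f) * g)
  regroup′ = solve-∀

data Dyck : ℕ → ℕ → Set where
  []   : Dyck 0 0
  rise : ∀ {ht a} → Dyck (suc ht) a → Dyck ht (suc a)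
  fall : ∀ {ht a} → Dyck ht a → Dyck (suc ht) a

ballot : ℕ → ℕ → ℕ
ballot zero     zero    = 1
ballot zero     (suc a) = ballot 1 a
ballot (suc ht) zero    = ballot ht zero
ballot (suc ht) (suc a) = ballot (suc (suc ht)) a + ballot ht (suc a)

ballot-zero : ∀ ht → ballot ht 0 ≡ 1
ballot-zero zero     = refl
ballot-zero (suc ht) = ballot-zero ht

-- Stated for every t equal to ht + 2a + 1 so that Pascal's rule applies without rewriting.
ballot-reflection : ∀ ht a t → ht + (a + suc a) ≡ t → ballot ht (suc a) + (suc t C a) ≡ suc t C suc a
ballot-reflection zero     zero    _ refl = refl
ballot-reflection zero     (suc a) _ refl = begin
  b + (suc N C suc a)             ≡⟨ cong (b +_) (pascal N a) ⟩
  b + ((N C a) + (N C suc a))     ≡⟨ +-assoc b (N C a) (N C suc a) ⟨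
  b + (N C a) + (N C suc a)       ≡⟨ cong (_+ (N C suc a)) (ballot-reflection 1 a _ (sym (+-suc a (suc a)))) ⟩
  (N C suc a) + (N C suc a)       ≡⟨ cong ((N C suc a) +_) (C-symmetric (suc a) (suc (suc a))) ⟩
  (N C suc a) + (N C suc (suc a)) ≡⟨ pascal N (suc a) ⟨
  suc N C suc (suc a)             ∎
  where
  open ≡-Reasoning
  N = suc a + suc (suc a)
  b = ballot 1 (suc a)
ballot-reflection (suc ht) zero    _ refl = begin
  ballot (suc (suc ht)) 0 + ballot ht 1 + 1 ≡⟨ cong (λ x → x + ballot ht 1 + 1) (ballot-zero (suc (suc ht))) ⟩
  1 + (ballot ht 1 + 1)                     ≡⟨ cong suc (ballot-reflection ht 0 _ refl) ⟩
  1 + (N C 1)                               ≡⟨ pascal N 0 ⟨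
  suc N C 1                                 ∎
  where
  open ≡-Reasoning
  N = suc (ht + 1)
ballot-reflection (suc ht) (suc a) _ refl = begin
  (b₁ + b₂) + (suc N C suc a)         ≡⟨ cong ((b₁ + b₂) +_) (pascal N a) ⟩
  (b₁ + b₂) + ((N C a) + (N C suc a)) ≡⟨ interchange b₁ b₂ (N C a) (N C suc a) ⟩
  (b₁ + (N C a)) + (b₂ + (N C suc a)) ≡⟨ cong₂ _+_ (ballot-reflection (suc (suc ht)) a _ (shift ht a))
                                                   (ballot-reflection ht (suc a) _ refl) ⟩
  (N C suc a) + (N C suc (suc a))     ≡⟨ pascal N (suc a) ⟨
  suc N C suc (suc a)                 ∎
  where
  open ≡-Reasoning
  N = suc (ht + (suc a + suc (suc a)))
  b₁ = ballot (suc (suc ht)) (suc a)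
  b₂ = ballot ht (suc (suc a))
  shift : ∀ ht a → suc (suc ht) + (a + suc a) ≡ ht + (suc a + suc (suc a))
  shift = solve-∀

ballot≡catalan : ∀ k → ballot 0 k ≡ catalan k
ballot≡catalan zero    = refl
ballot≡catalan (suc k) = sym (begin
  ((2 * suc k) C suc k) / suc (suc k) ≡⟨ cong (λ m → ((suc k + m) C suc k) / suc (suc k)) (+-identityʳ (suc k)) ⟩
  (T C suc k) / suc (suc k)           ≡⟨ cong (_/ suc (suc k)) scaled ⟨
  suc (suc k) * b / suc (suc k)      ≡⟨ cong (_/ suc (suc k)) (*-comm (suc (suc k)) b) ⟩
  b * suc (suc k) / suc (suc k)      ≡⟨ m*n/n≡m b (suc (suc k)) ⟩
  b                                  ∎)
  where
  open ≡-Reasoning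
  T = suc k + suc k
  b = ballot 0 (suc k)
  scaled : suc (suc k) * b ≡ T C suc k
  scaled = +-cancelʳ-≡ _ _ _ (begin
    suc (suc k) * b + suc k * (T C suc k)   ≡⟨ cong (suc (suc k) * b +_) (C-ratio k (suc k)) ⟨
    suc (suc k) * b + suc (suc k) * (T C k) ≡⟨ *-distribˡ-+ (suc (suc k)) b (T C k) ⟨
    suc (suc k) * (b + (T C k))             ≡⟨ cong (suc (suc k) *_) (ballot-reflection 0 k _ refl) ⟩
    suc (suc k) * (T C suc k)               ≡⟨⟩
    (T C suc k) + suc k * (T C suc k)       ∎)

Fin-cong : ∀ {m n} → m ≡ n → Fin m ↔ Fin n
Fin-cong refl = ↔-refl

data Shuffle : ℕ → ℕ → Set where
  []    : Shuffle 0 0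
  left  : ∀ {a b} → Shuffle a b → Shuffle (suc a) b
  right : ∀ {a b} → Shuffle a b → Shuffle a (suc b)

Shuffle↔C : ∀ a b → Shuffle a b ↔ Fin ((a + b) C a)
Shuffle↔C zero    zero    = mk↔ₛ′ (λ _ → Fin.zero) (λ _ → []) (λ { Fin.zero → refl ; (Fin.suc ()) }) (λ { [] → refl })
Shuffle↔C zero    (suc b) = ↔-trans (mk↔ₛ′ (λ { (right p) → p }) right (λ _ → refl) (λ { (right _) → refl }))
                                    (Shuffle↔C 0 b)
Shuffle↔C (suc a) zero    = ↔-trans (mk↔ₛ′ (λ { (left p) → p }) left (λ _ → refl) (λ { (left _) → refl }))
                                    (↔-trans (Shuffle↔C a 0) (Fin-cong (trans (diagonal a) (sym (diagonal (suc a))))))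
  where
  diagonal : ∀ a → (a + 0) C a ≡ 1
  diagonal a = trans (cong (_C a) (+-identityʳ a)) (nCn≡1 a)
Shuffle↔C (suc a) (suc b) =
  ↔-trans (mk↔ₛ′ (λ { (left p) → inj₁ p ; (right p) → inj₂ p }) [ left , right ]′
                 (λ { (inj₁ _) → refl ; (inj₂ _) → refl }) (λ { (left _) → refl ; (right _) → refl }))
          (↔-trans (Shuffle↔C a (suc b) ⊎-↔ Shuffle↔C (suc a) b) (↔-trans (↔-sym +↔⊎) (Fin-cong pascal′)))
  where
  pascal′ : (a + suc b) C a + (suc a + b) C suc a ≡ (suc a + suc b) C suc a
  pascal′ = trans (cong (λ m → (a + suc b) C a + m C suc a) (sym (+-suc a b)))
                  (nCk+nC[k+1]≡[n+1]C[k+1] (a + suc b) a)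

Dyck↔ballot : ∀ ht a → Dyck ht a ↔ Fin (ballot ht a)
Dyck↔ballot zero    zero    = mk↔ₛ′ (λ _ → Fin.zero) (λ _ → []) (λ { Fin.zero → refl ; (Fin.suc ()) }) (λ { [] → refl })
Dyck↔ballot zero    (suc a) = ↔-trans (mk↔ₛ′ (λ { (rise y) → y }) rise (λ _ → refl) (λ { (rise _) → refl }))
                                      (Dyck↔ballot 1 a)
Dyck↔ballot (suc ht) zero   = ↔-trans (mk↔ₛ′ (λ { (fall y) → y }) fall (λ _ → refl) (λ { (fall _) → refl }))
                                      (Dyck↔ballot ht 0)
Dyck↔ballot (suc ht) (suc a) =
  ↔-trans (mk↔ₛ′ (λ { (rise y) → inj₁ y ; (fall y) → inj₂ y }) [ rise , fall ]′
                 (λ { (inj₁ _) → refl ; (inj₂ _) → refl }) (λ { (rise _) → refl ; (fall _) → refl }))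
          (↔-trans (Dyck↔ballot (suc (suc ht)) a ⊎-↔ Dyck↔ballot ht (suc a)) (↔-sym +↔⊎))

Fin-sum↔Σ : ∀ (g : ℕ → ℕ) L → Fin (sum (applyUpTo g L)) ↔ (Σ[ j ∈ ℕ ] (j < L × Fin (g j)))
Fin-sum↔Σ g zero    = mk↔ₛ′ (λ ()) (λ { (_ , () , _) }) (λ { (_ , () , _) }) (λ ())
Fin-sum↔Σ g (suc L) = ↔-trans +↔⊎ (↔-trans (↔-refl ⊎-↔ Fin-sum↔Σ (λ j → g (suc j)) L)
  (mk↔ₛ′ (λ { (inj₁ x) → 0 , s≤s z≤n , x ; (inj₂ (j , j<L , x)) → suc j , s≤s j<L , x })
         (λ { (zero , _ , x) → inj₁ x ; (suc j , s≤s j<L , x) → inj₂ (j , j<L , x) })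
         (λ { (zero , s≤s z≤n , _) → refl ; (suc _ , s≤s _ , _) → refl })
         (λ { (inj₁ _) → refl ; (inj₂ _) → refl })))

props↔ : ∀ {A B : Set} → Irrelevant A → Irrelevant B → (A → B) → (B → A) → A ↔ B
props↔ A-irr B-irr to from = mk↔ₛ′ to from (λ _ → B-irr _ _) (λ _ → A-irr _ _)

Σ-solve : ∀ {X : ℕ → Set} c {n} → (Σ[ m ∈ ℕ ] (X m × c + m ≡ n)) ↔ (c ≤ n × X (n ∸ c))
Σ-solve {X} c {n} = mk↔ₛ′ to from to-from from-to
  where
  solved : ∀ {m} → c + m ≡ n → m ≡ n ∸ c
  solved {m} eq = trans (sym (m+n∸m≡n c m)) (cong (_∸ c) eq)

  to : Σ[ m ∈ ℕ ] (X m × c + m ≡ n) → c ≤ n × X (n ∸ c)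
  to (m , x , eq) = subst (c ≤_) eq (m≤m+n c m) , subst X (solved eq) x

  from : c ≤ n × X (n ∸ c) → Σ[ m ∈ ℕ ] (X m × c + m ≡ n)
  from (c≤n , x) = n ∸ c , x , m+[n∸m]≡n c≤n

  to-from : ∀ y → to (from y) ≡ y
  to-from (c≤n , x) = cong₂ _,_ (≤-irrelevant _ _) (cong (λ eq → subst X eq x) (≡-irrelevant _ refl))

  from-to : ∀ y → from (to y) ≡ y
  from-to (m , x , eq) = relocate (solved eq)
    where
    relocate : ∀ {m′} (m≡m′ : m ≡ m′) {eq′ : c + m′ ≡ n} → (m′ , subst X m≡m′ x , eq′) ≡ (m , x , eq)
    relocate refl = cong (λ eq′ → m , x , eq′) (≡-irrelevant _ _)

data Walk : ℕ → ℕ → ℕ → Set where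
  []  : Walk 0 0 0
  u∷_ : ∀ {ht n i} → Walk (suc ht) n i → Walk ht (suc n) i
  d∷_ : ∀ {ht n i} → Walk ht n i → Walk (suc ht) (suc n) (suc i)
  h∷_ : ∀ {ht n i} → Walk ht n i → Walk ht (suc n) i
  v∷_ : ∀ {ht n i} → Walk ht n i → Walk (suc ht) n i

Path : ℕ → ℕ → ℕ → Set
Path ht n i = Σ (List Step) (λ s → GWalk ht s × len s ≡ n × #d s ≡ i)

walk : ∀ {ht s} → GWalk ht s → Walk ht (len s) (#d s)
walk done     = []
walk (up g)   = u∷ walk g
walk (down g) = d∷ walk g
walk (hor g)  = h∷ walk g
walk (vert g) = v∷ walk g

path : ∀ {ht n i} → Walk ht n i → Path ht n i
path []     = [] , done , refl , refl
path (u∷ w) with path w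
... | s , g , p , q = u ∷ s , up g , cong suc p , q
path (d∷ w) with path w
... | s , g , p , q = d ∷ s , down g , cong suc p , cong suc q
path (h∷ w) with path w
... | s , g , p , q = h ∷ s , hor g , cong suc p , q
path (v∷ w) with path w
... | s , g , p , q = v ∷ s , vert g , p , q

Path↔Walk : ∀ {ht n i} → Path ht n i ↔ Walk ht n i
Path↔Walk = mk↔ₛ′ from-path path walk-path path-walk
  where
  from-path : ∀ {ht n i} → Path ht n i → Walk ht n i
  from-path (_ , g , refl , refl) = walk g

  walk-path : ∀ {ht n i} (w : Walk ht n i) → from-path (path w) ≡ w
  walk-path []     = refl
  walk-path (u∷ w) with path w | walk-path w
  ... | _ , _ , refl , refl | ih = cong u∷_ ih
  walk-path (d∷ w) with path w | walk-path w
  ... | _ , _ , refl , refl | ih = cong d∷_ ih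
  walk-path (h∷ w) with path w | walk-path w
  ... | _ , _ , refl , refl | ih = cong h∷_ ih
  walk-path (v∷ w) with path w | walk-path w
  ... | _ , _ , refl , refl | ih = cong v∷_ ih

  path-walk : ∀ {ht n i} (x : Path ht n i) → path (from-path x) ≡ x
  path-walk (_ , g , refl , refl) = path-walk′ g
    where
    path-walk′ : ∀ {ht s} (g : GWalk ht s) → path (walk g) ≡ (s , g , refl , refl)
    path-walk′ done = refl
    path-walk′ (up g)   rewrite path-walk′ g = refl
    path-walk′ (down g) rewrite path-walk′ g = refl
    path-walk′ (hor g)  rewrite path-walk′ g = refl
    path-walk′ (vert g) rewrite path-walk′ g = refl

data Skeleton : ℕ → ℕ → ℕ → ℕ → Set where
  []  : Skeleton 0 0 0 0
  u∷_ : ∀ {ht ℓ i e} → Skeleton (suc ht) ℓ i e → Skeleton ht (suc ℓ) i (suc e)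
  d∷_ : ∀ {ht ℓ i e} → Skeleton ht ℓ i e → Skeleton (suc ht) (suc ℓ) (suc i) (suc e)
  v∷_ : ∀ {ht ℓ i e} → Skeleton ht ℓ i e → Skeleton (suc ht) ℓ i (suc e)

HorizontalSplit : ℕ → ℕ → ℕ → Set
HorizontalSplit ht n i =
  Σ[ ℓ ∈ ℕ ] Σ[ e ∈ ℕ ] Σ[ m ∈ ℕ ] (Skeleton ht ℓ i e × Shuffle e m) × ℓ + m ≡ n

split : ∀ {ht n i} → Walk ht n i → HorizontalSplit ht n i
split []     = 0 , 0 , 0 , ([] , []) , refl
split (u∷ w) with split w
... | ℓ , e , m , (s , p) , eq = suc ℓ , suc e , m , (u∷ s , left p) , cong suc eq
split (d∷ w) with split w
... | ℓ , e , m , (s , p) , eq = suc ℓ , suc e , m , (d∷ s , left p) , cong suc eq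
split (h∷ w) with split w
... | ℓ , e , m , (s , p) , eq = ℓ , e , suc m , (s , right p) , trans (+-suc ℓ m) (cong suc eq)
split (v∷ w) with split w
... | ℓ , e , m , (s , p) , eq = ℓ , suc e , m , (v∷ s , left p) , eq

merge : ∀ {ht ℓ i e m} → Shuffle e m → Skeleton ht ℓ i e → ∀ {n} → ℓ + m ≡ n → Walk ht n i
merge []        []     refl = []
merge (left p)  (u∷ s) refl = u∷ merge p s refl
merge (left p)  (d∷ s) refl = d∷ merge p s refl
merge (left p)  (v∷ s) eq   = v∷ merge p s eq
merge (right _) _ {zero}  eq = ⊥-elim (m+1+n≢0 _ eq)
merge (right p) s {suc _} eq = h∷ merge p s (suc-injective (trans (sym (+-suc _ _)) eq))

Walk↔HorizontalSplit : ∀ {ht n i} → Walk ht n i ↔ HorizontalSplit ht n i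
Walk↔HorizontalSplit = mk↔ₛ′ split join split-join join-split
  where
  join : ∀ {ht n i} → HorizontalSplit ht n i → Walk ht n i
  join (_ , _ , _ , (s , p) , eq) = merge p s eq

  join-split : ∀ {ht n i} (w : Walk ht n i) → join (split w) ≡ w
  join-split []     = refl
  join-split (u∷ w) with split w | join-split w
  ... | _ , _ , _ , _ , refl | ih = cong u∷_ ih
  join-split (d∷ w) with split w | join-split w
  ... | _ , _ , _ , _ , refl | ih = cong d∷_ ih
  join-split (h∷ w) with split w | join-split w
  ... | _ , _ , _ , (s , p) , _ | ih = cong h∷_ (trans (cong (merge p s) (≡-irrelevant _ _)) ih)
  join-split (v∷ w) with split w | join-split w
  ... | _ , _ , _ , (s , p) , _ | ih = cong v∷_ ih

  split-merge : ∀ {ht ℓ i e m} (p : Shuffle e m) (s : Skeleton ht ℓ i e) {n} (eq : ℓ + m ≡ n) →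
                split (merge p s eq) ≡ (ℓ , e , m , (s , p) , eq)
  split-merge []        []     refl = refl
  split-merge (left p)  (u∷ s) refl rewrite split-merge p s refl = refl
  split-merge (left p)  (d∷ s) refl rewrite split-merge p s refl = refl
  split-merge (left p)  (v∷ s) eq   rewrite split-merge p s eq = refl
  split-merge (right _) _ {zero}  eq = ⊥-elim (m+1+n≢0 _ eq)
  split-merge (right p) s {suc _} eq
    rewrite split-merge p s (suc-injective (trans (sym (+-suc _ _)) eq)) =
    cong (λ eq′ → _ , _ , _ , (s , right p) , eq′) (≡-irrelevant _ _)

  split-join : ∀ {ht n i} (x : HorizontalSplit ht n i) → split (join x) ≡ x
  split-join (_ , _ , _ , (s , p) , eq) = split-merge p s eq

-- The shuffle marks which of the ht + a down-steps of the Dyck walk are d-steps rather than v-steps.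
ColouredDyck : ℕ → ℕ → ℕ → ℕ → Set
ColouredDyck ht ℓ i e =
  Σ[ a ∈ ℕ ] Σ[ j ∈ ℕ ] (Dyck ht a × Shuffle i j) × i + j ≡ ht + a × a + i ≡ ℓ × (ht + a) + a ≡ e

rise-size : ∀ ht a → (ht + suc a) + suc a ≡ suc ((suc ht + a) + a)
rise-size ht a = trans (cong (_+ suc a) (+-suc ht a)) (+-suc (suc ht + a) a)

colour : ∀ {ht ℓ i e} → Skeleton ht ℓ i e → ColouredDyck ht ℓ i e
colour []     = 0 , 0 , ([] , []) , refl , refl , refl
colour {ht} (u∷ s) with colour s
... | a , j , (y , c) , p , q , r =
  suc a , j , (rise y , c) , trans p (sym (+-suc ht a)) , cong suc q , trans (rise-size ht a) (cong suc r)
colour (d∷ s) with colour s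
... | a , j , (y , c) , p , q , r = a , j , (fall y , left c) , cong suc p , trans (+-suc a _) (cong suc q) , cong suc r
colour (v∷ s) with colour s
... | a , j , (y , c) , p , q , r = a , suc j , (fall y , right c) , trans (+-suc _ j) (cong suc p) , q , cong suc r

uncolour : ∀ {ht a i j ℓ e} → Dyck ht a → Shuffle i j →
           i + j ≡ ht + a → a + i ≡ ℓ → (ht + a) + a ≡ e → Skeleton ht ℓ i e
uncolour []       []        _  refl refl = []
uncolour []       (left _)  () _    _
uncolour []       (right _) p  _    _    = ⊥-elim (m+1+n≢0 _ p)
uncolour {ht} {suc a} {e = zero}  (rise _) _ _ _    r = ⊥-elim (m+1+n≢0 (ht + suc a) r)
uncolour {ht} {suc a} {e = suc _} (rise y) c p refl r =
  u∷ uncolour y c (trans p (+-suc ht a)) refl (suc-injective (trans (sym (rise-size ht a)) r))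
uncolour (fall y) (right c) p refl refl = v∷ uncolour y c (suc-injective (trans (sym (+-suc _ _)) p)) refl refl
uncolour {ℓ = zero}  (fall _) (left _) _ q _    = ⊥-elim (m+1+n≢0 _ q)
uncolour {ℓ = suc _} (fall y) (left c) p q refl =
  d∷ uncolour y c (suc-injective p) (suc-injective (trans (sym (+-suc _ _)) q)) refl

Skeleton↔ColouredDyck : ∀ {ht ℓ i e} → Skeleton ht ℓ i e ↔ ColouredDyck ht ℓ i e
Skeleton↔ColouredDyck = mk↔ₛ′ colour uncolour′ colour-uncolour′ uncolour-colour
  where
  uncolour′ : ∀ {ht ℓ i e} → ColouredDyck ht ℓ i e → Skeleton ht ℓ i e
  uncolour′ (_ , _ , (y , c) , p , q , r) = uncolour y c p q r

  uncolour-irrelevant : ∀ {ht a i j ℓ e} (y : Dyck ht a) (c : Shuffle i j) {p p′ q q′ r r′} →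
                        uncolour {ℓ = ℓ} {e} y c p q r ≡ uncolour y c p′ q′ r′
  uncolour-irrelevant y c {p} {p′} {q} {q′} {r} {r′}
    rewrite ≡-irrelevant p p′ | ≡-irrelevant q q′ | ≡-irrelevant r r′ = refl

  uncolour-colour : ∀ {ht ℓ i e} (s : Skeleton ht ℓ i e) → uncolour′ (colour s) ≡ s
  uncolour-colour []     = refl
  uncolour-colour (u∷ s) with colour s | uncolour-colour s
  ... | _ , _ , (y , c) , _ , refl , _ | ih = cong u∷_ (trans (uncolour-irrelevant y c) ih)
  uncolour-colour (d∷ s) with colour s | uncolour-colour s
  ... | _ , _ , (y , c) , _ , refl , refl | ih = cong d∷_ (trans (uncolour-irrelevant y c) ih)
  uncolour-colour (v∷ s) with colour s | uncolour-colour s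
  ... | _ , _ , (y , c) , _ , refl , refl | ih = cong v∷_ (trans (uncolour-irrelevant y c) ih)

  coloured-irrelevant : ∀ {ht ℓ i e a j} (x : Dyck ht a × Shuffle i j) {p p′ q q′ r r′} →
                        _≡_ {A = ColouredDyck ht ℓ i e} (a , j , x , p , q , r) (a , j , x , p′ , q′ , r′)
  coloured-irrelevant x {p} {p′} {q} {q′} {r} {r′}
    rewrite ≡-irrelevant p p′ | ≡-irrelevant q q′ | ≡-irrelevant r r′ = refl

  colour-uncolour : ∀ {ht a i j ℓ e} (y : Dyck ht a) (c : Shuffle i j) p q r →
                    colour (uncolour {ℓ = ℓ} {e} y c p q r) ≡ (a , j , (y , c) , p , q , r)
  colour-uncolour []       []        _  refl refl = coloured-irrelevant ([] , [])
  colour-uncolour []       (left _)  () _    _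
  colour-uncolour []       (right _) p  _    _    = ⊥-elim (m+1+n≢0 _ p)
  colour-uncolour {ht} {suc a} {e = zero}  (rise _) _ _ _    r = ⊥-elim (m+1+n≢0 (ht + suc a) r)
  colour-uncolour {ht} {suc a} {e = suc _} (rise y) c p refl r
    rewrite colour-uncolour y c (trans p (+-suc ht a)) refl (suc-injective (trans (sym (rise-size ht a)) r)) =
    coloured-irrelevant (rise y , c)
  colour-uncolour (fall y) (right c) p refl refl
    rewrite colour-uncolour y c (suc-injective (trans (sym (+-suc _ _)) p)) refl refl =
    coloured-irrelevant (fall y , right c)
  colour-uncolour {ℓ = zero}  (fall _) (left _) _ q _ = ⊥-elim (m+1+n≢0 _ q)
  colour-uncolour {ℓ = suc _} (fall y) (left c) p q refl
    rewrite colour-uncolour y c (suc-injective p) (suc-injective (trans (sym (+-suc _ _)) q)) refl =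
    coloured-irrelevant (fall y , left c)

  colour-uncolour′ : ∀ {ht ℓ i e} (x : ColouredDyck ht ℓ i e) → colour (uncolour′ x) ≡ x
  colour-uncolour′ (_ , _ , (y , c) , p , q , r) = colour-uncolour y c p q r

-- For a G-Motzkin path with i d-steps, j v-steps and m h-steps: the d/v colouring, the positions
-- of the h-steps, and the Dyck path of semilength i + j.
Decomposition : ℕ → ℕ → ℕ → Set
Decomposition i j m = (Shuffle i j × Shuffle ((i + j) + (i + j)) m) × Dyck 0 (i + j)

flatten : ∀ {n i} →
  (Σ[ ℓ ∈ ℕ ] Σ[ e ∈ ℕ ] Σ[ m ∈ ℕ ] (ColouredDyck 0 ℓ i e × Shuffle e m) × ℓ + m ≡ n) ↔
  (Σ[ j ∈ ℕ ] Σ[ m ∈ ℕ ] (Decomposition i j m × (i + j) + i + m ≡ n))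
flatten {n} {i} = mk↔ₛ′
  (λ { (_ , _ , m , ((_ , j , (y , c) , refl , refl , refl) , p) , eq) → j , m , ((c , p) , y) , eq })
  (λ { (j , m , ((c , p) , y) , eq) → _ , _ , m , ((i + j , j , (y , c) , refl , refl , refl) , p) , eq })
  (λ _ → refl)
  (λ { (_ , _ , _ , ((_ , _ , _ , refl , refl , refl) , _) , _) → refl })

fits⇒in-range : ∀ {n i} j → (i + j) + i ≤ n → j < suc (n ∸ i) ∸ i
fits⇒in-range {n} {i} j fits =
  m+n≤o⇒m≤o∸n (suc j) (s≤s (m+n≤o⇒m≤o∸n (j + i) (subst (λ x → x + i ≤ n) (+-comm i j) fits)))

in-range⇒fits : ∀ {n i} j → i ≤ n → j < suc (n ∸ i) ∸ i → (i + j) + i ≤ n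
in-range⇒fits {n} {i} j i≤n j<L =
  subst (λ x → x + i ≤ n) (+-comm j i) (m≤o∸n⇒m+n≤o (j + i) i≤n (s≤s⁻¹ (m≤o∸n⇒m+n≤o (suc j) i≤1+n∸i j<L)))
  where
  i≤1+n∸i : i ≤ suc (n ∸ i)
  i≤1+n∸i = <⇒≤ (m∸n≢0⇒n<m (λ L≡0 → n≮0 (subst (j <_) L≡0 j<L)))

k+k+m≡[k+i+m∸i]+k : ∀ k i m → (k + k) + m ≡ ((k + i) + m ∸ i) + k
k+k+m≡[k+i+m∸i]+k k i m = begin
  (k + k) + m           ≡⟨ swap k m ⟩
  (k + m) + k           ≡⟨ cong (_+ k) (m+n∸m≡n i (k + m)) ⟨
  (i + (k + m) ∸ i) + k ≡⟨ cong (λ x → (x ∸ i) + k) (front i k m) ⟩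
  ((k + i) + m ∸ i) + k ∎
  where
  open ≡-Reasoning
  swap : ∀ k m → (k + k) + m ≡ (k + m) + k
  swap = solve-∀
  front : ∀ i k m → i + (k + m) ≡ (k + i) + m
  front = solve-∀

Decomposition↔Fin : ∀ {n i} j → (i + j) + i ≤ n →
  Decomposition i j (n ∸ ((i + j) + i)) ↔ Fin (((i + j) C i) * (((n ∸ i) + (i + j)) C (2 * (i + j))) * catalan (i + j))
Decomposition↔Fin {n} {i} j fits = begin
  Decomposition i j m₀
    ↔⟨ (Shuffle↔C i j ×-↔ Shuffle↔C (k + k) m₀) ×-↔ Dyck↔ballot 0 k ⟩
  ((Fin (k C i) × Fin ((k + k + m₀) C (k + k))) × Fin (ballot 0 k))
    ≡⟨ cong₂ (λ x y → (Fin (k C i) × Fin x) × Fin y) (cong₂ _C_ top (cong (k +_) (sym (+-identityʳ k))))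
             (ballot≡catalan k) ⟩
  ((Fin (k C i) × Fin (((n ∸ i) + k) C (2 * k))) × Fin (catalan k))
    ↔⟨ *↔× ×-↔ ↔-refl ⟨
  (Fin ((k C i) * (((n ∸ i) + k) C (2 * k))) × Fin (catalan k))
    ↔⟨ *↔× ⟨
  Fin ((k C i) * (((n ∸ i) + k) C (2 * k)) * catalan k)
    ∎
  where
  open EquationalReasoning {k = bijection}
  k  = i + j
  m₀ = n ∸ (k + i)
  top : (k + k) + m₀ ≡ (n ∸ i) + k
  top = trans (k+k+m≡[k+i+m∸i]+k k i m₀) (cong (λ x → (x ∸ i) + k) (m+[n∸m]≡n fits))

fibre↔Fin : ∀ {n i} j → i ≤ n →
  (Σ[ m ∈ ℕ ] (Decomposition i j m × (i + j) + i + m ≡ n)) ↔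
  (j < suc (n ∸ i) ∸ i × Fin (((i + j) C i) * (((n ∸ i) + (i + j)) C (2 * (i + j))) * catalan (i + j)))
fibre↔Fin {n} {i} j i≤n =
  ↔-trans (Σ-solve {Decomposition i j} ((i + j) + i))
          (Σ-cong {k = bijection} (props↔ ≤-irrelevant <-irrelevant (fits⇒in-range {n} {i} j) (in-range⇒fits j i≤n))
                  (λ {fits} → Decomposition↔Fin {n} {i} j fits))

theorem2p7 : (n i : ℕ) → i ≤ n →
    Fin (sumRange i (n ∸ i) (λ k → (k C i) * (((n ∸ i) + k) C (2 * k)) * catalan k)) ↔ GMotzkin n i
theorem2p7 n i i≤n = begin
  Fin (sum (map g (upTo L)))                                 ≡⟨ cong (λ xs → Fin (sum xs)) (map-upTo g L) ⟩
  Fin (sum (applyUpTo g L))                                  ↔⟨ Fin-sum↔Σ g L ⟩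
  (Σ[ j ∈ ℕ ] (j < L × Fin (g j)))                           ↔⟨ congˡ {k = bijection} (fibre↔Fin _ i≤n) ⟨
  (Σ[ j ∈ ℕ ] Σ[ m ∈ ℕ ] (Decomposition i j m × (i + j) + i + m ≡ n)) ↔⟨ flatten ⟨
  (Σ[ ℓ ∈ ℕ ] Σ[ e ∈ ℕ ] Σ[ m ∈ ℕ ] (ColouredDyck 0 ℓ i e × Shuffle e m) × ℓ + m ≡ n)
      ↔⟨ congˡ {k = bijection} (congˡ {k = bijection} (congˡ {k = bijection}
            ((Skeleton↔ColouredDyck ×-↔ ↔-refl) ×-↔ ↔-refl))) ⟨
  HorizontalSplit 0 n i                                      ↔⟨ Walk↔HorizontalSplit ⟨
  Walk 0 n i                                                 ↔⟨ Path↔Walk ⟨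
  GMotzkin n i                                               ∎
  where
  open EquationalReasoning {k = bijection}
  L = suc (n ∸ i) ∸ i
  g : ℕ → ℕ
  g j = ((i + j) C i) * (((n ∸ i) + (i + j)) C (2 * (i + j))) * catalan (i + j)
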